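{- The functor $\overline{\mathcal{F}}:\mathrm{Cob}_0\to\mathbf{Project}$, which is the identity on objects and sends a cobordism $M\in\mathrm{Hom}_{\mathrm{Cob}_0}(A,B)$ to the project $(\Gamma_1(M), n_M)$, where $n_M$ is the number of circle (boundaryless) components of $M$, is faithful.
   Context: $\mathrm{Cob}_0$ is the category whose objects are $0$-dimensional smooth manifolds (finite sets of points) and whose morphisms from $A$ to $B$ are $1$-dimensional smooth manifolds $M$ (finite disjoint unions of segments and circles) with boundary $\partial M=A\sqcup B$, considered up to diffeomorphism fixing the boundary; composition of $M:A\to B$ and $N:B\to C$ is $M;N=(M\sqcup N)/\sim$, gluing along the common boundary $B$. A directed graph $G=(V^G,E^G,s^G,t^G)$ has a finite vertex set, edge set and source/target maps. For graphs $G,H$, an alternating path is a sequence of consecutive edges $e_1\cdots e_n$ (i.e. $s(e_{i+1})=t(e_i)$) with $e_i\in E^G$ iff $e_{i+1}\in E^H$; an alternating cycle is an alternating path whose source equals its target and with $e_1\in E^G$ iff $e_n\in E^H$; it is prime if it is not of the form $\rho^k$ with $k>1$. $\mathcal{C}(G,H)$ denotes the set of alternating prime cycles. The execution $G\,\square\,H$ is the graph on $V^G\triangle V^H$ whose edges are the finite maximal alternating paths with source and target in $V^G\triangle V^H$. $\mathbf{Project}$ is the category whose objects are finite sets and whose morphisms $A\to B$ are projects $(G,a)$ consisting of a directed graph $G$ on $A+B$ and a number $a$ (the wager); composition is $(A,a)\,\square\,(B,b)=(A\,\square\,B,\ a+b+|\mathcal{C}(A,B)|)$. For $M\in\mathrm{Hom}_{\mathrm{Cob}_0}(A,B)$,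 the fundamental graph $\Gamma_1(M)$ has vertex set $A\sqcup B$, edges the homotopy classes relative to endpoints $[p]$ of paths $p:[0,1]\to M$ with $p(0),p(1)\in A\sqcup B$ and $p(0)\neq p(1)$, with $s([p])=p(0)$ and $t([p])=p(1)$. A functor is faithful if it is injective on each hom-set. -}

module Defs where

open import Data.Nat using (ℕ)
open import Data.Fin using (Fin)
open import Data.Fin.Properties using () renaming (_≟_ to _≟ᶠ_)
open import Data.Bool using (Bool; true; false; T; not; _∧_)
open import Data.Sum using (_⊎_; inj₁; inj₂)
open import Data.Sum.Properties using (≡-dec)
open import Data.Product using (Σ; Σ-syntax; _×_; _,_; proj₁; proj₂; swap)
open import Data.List using (List; []; _∷_)
open import Relation.Binary.PropositionalEquality using (_≡_)
open import Relation.Nullary.Decidable using (⌊_⌋)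
open import Function.Definitions using (Bijective)
open import Function.Bundles using (_↔_; Inverse)

-- Objects of Cob₀ and of Project: finite sets, represented as Fin n.
-- The boundary A ⊔ B of a morphism A → B.

Bd : ℕ → ℕ → Set
Bd a b = Fin a ⊎ Fin b

_≟Bd_ : ∀ {a b} (x y : Bd a b) → Bool
x ≟Bd y = ⌊ ≡-dec _≟ᶠ_ _≟ᶠ_ x y ⌋

-- Morphisms of Cob₀ : a compact 1-manifold M with ∂M = A ⊔ B, given as
-- a finite disjoint union of segments and circles (as in the paper).
-- Segment i is a copy of [0,1] whose endpoints 0 and 1 are the boundary
-- points  proj₁ (ends i)  and  proj₂ (ends i).  The condition ∂M = A ⊔ B
-- says that the map (segment , end) ↦ boundary point is a bijection.

endpt : ∀ {a b n} → (Fin n → Bd a b × Bd a b) → Fin n × Bool → Bd a b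
endpt ends (i , false) = proj₁ (ends i)
endpt ends (i , true)  = proj₂ (ends i)

record Cob (a b : ℕ) : Set where
  field
    nseg     : ℕ
    ends     : Fin nseg → Bd a b × Bd a b
    ncirc    : ℕ
    boundary : Bijective _≡_ _≡_ (endpt {a} {b} {nseg} ends)
open Cob public

-- Diffeomorphism fixing the boundary: a bijection of the segments
-- (each segment mapped onto one with the same endpoints, possibly
-- reversing its parametrisation) and equally many circles.
_≅Cob_ : ∀ {a b} → Cob a b → Cob a b → Set
M ≅Cob N =
  Σ[ σ ∈ (Fin (nseg M) ↔ Fin (nseg N)) ]
    ((∀ i → (ends N (Inverse.to σ i) ≡ ends M i)
           ⊎ (ends N (Inverse.to σ i) ≡ swap (ends M i)))
     × ncirc M ≡ ncirc N)

record Graph (V : Set) : Set₁ where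
  field
    E   : Set
    src : E → V
    tgt : E → V
open Graph public

_≅G_ : ∀ {V} → Graph V → Graph V → Set
G ≅G H = Σ[ φ ∈ (E G ↔ E H) ]
           ((∀ e → src H (Inverse.to φ e) ≡ src G e)
          × (∀ e → tgt H (Inverse.to φ e) ≡ tgt G e))

record Proj (a b : ℕ) : Set₁ where
  field
    graph : Graph (Bd a b)
    wager : ℕ
open Proj public

_≅P_ : ∀ {a b} → Proj a b → Proj a b → Set
P ≅P Q = (graph P ≅G graph Q) × (wager P ≡ wager Q)

-- M is given the cell structure with one 1-cell per segment (from its
-- endpoint 0 to its endpoint 1) and, for each circle, one 0-cell with a
-- loop.  Homotopy classes of paths rel endpoints in (the realisation of)
-- a graph are in bijection with reduced edge paths (no immediate
-- backtracking); we use these as the combinatorial model of [p].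

CV : ∀ {a b} → Cob a b → Set
CV {a} {b} M = Bd a b ⊎ Fin (ncirc M)

CE : ∀ {a b} → Cob a b → Set
CE M = Fin (nseg M) ⊎ Fin (ncirc M)

_≟CV_ : ∀ {a b} {M : Cob a b} (x y : CV M) → Bool
_≟CV_ {M = M} x y = ⌊ ≡-dec (≡-dec _≟ᶠ_ _≟ᶠ_) _≟ᶠ_ x y ⌋

_≟CE_ : ∀ {a b} {M : Cob a b} (x y : CE M) → Bool
_≟CE_ {M = M} x y = ⌊ ≡-dec _≟ᶠ_ _≟ᶠ_ x y ⌋

cellSrc : ∀ {a b} (M : Cob a b) → CE M → CV M
cellSrc M (inj₁ i) = inj₁ (proj₁ (ends M i))
cellSrc M (inj₂ k) = inj₂ k

cellTgt : ∀ {a b} (M : Cob a b) → CE M → CV M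
cellTgt M (inj₁ i) = inj₁ (proj₂ (ends M i))
cellTgt M (inj₂ k) = inj₂ k

-- oriented 1-cells: false = traversed forwards, true = backwards
osrc : ∀ {a b} (M : Cob a b) → CE M × Bool → CV M
osrc M (e , false) = cellSrc M e
osrc M (e , true)  = cellTgt M e

otgt : ∀ {a b} (M : Cob a b) → CE M × Bool → CV M
otgt M (e , false) = cellTgt M e
otgt M (e , true)  = cellSrc M e

isPath : ∀ {a b} (M : Cob a b) → CV M → CV M → List (CE M × Bool) → Bool
isPath M x y []       = _≟CV_ {M = M} x y
isPath M x y (o ∷ os) = _≟CV_ {M = M} (osrc M o) x ∧ isPath M (otgt M o) y os

isReduced : ∀ {a b} (M : Cob a b) → List (CE M × Bool) → Bool
isReduced M []                  = true
isReduced M (o ∷ [])            = true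
isReduced M ((e , d) ∷ (e' , d') ∷ os) =
  not (_≟CE_ {M = M} e e' ∧ not ⌊ d Data.Bool.≟ d' ⌋) ∧ isReduced M ((e' , d') ∷ os)

Γ₁E : ∀ {a b} → Cob a b → Set
Γ₁E {a} {b} M =
  Σ[ x ∈ Bd a b ] Σ[ y ∈ Bd a b ]
    (T (not (x ≟Bd y)) ×
     Σ[ w ∈ List (CE M × Bool) ] (T (isPath M (inj₁ x) (inj₁ y) w) × T (isReduced M w)))

Γ₁ : ∀ {a b} → Cob a b → Graph (Bd a b)
Γ₁ M = record { E = Γ₁E M ; src = proj₁ ; tgt = λ e → proj₁ (proj₂ e) }

F̄ : ∀ {a b} → Cob a b → Proj a b
F̄ M = record { graph = Γ₁ M ; wager = ncirc M }

module Submission where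

open import Defs
open import Data.Nat using (ℕ)
open import Data.Fin using (Fin)
open import Data.Fin.Properties using () renaming (_≟_ to _≟ᶠ_)
open import Data.Bool using (Bool; true; false; T; not; _≟_)
open import Data.Bool.Properties using (T-∧; not-¬)
open import Data.Sum using (_⊎_; inj₁; inj₂)
open import Data.Sum.Properties using (≡-dec; inj₁-injective)
open import Data.Product using (Σ-syntax; _×_; _,_; proj₁; proj₂; swap)
open import Data.List using ([]; _∷_)
open import Data.Empty using (⊥; ⊥-elim)
open import Relation.Binary.PropositionalEquality
open import Relation.Nullary using (yes; no)
open import Relation.Nullary.Decidable using (toWitness; fromWitness; toWitnessFalse; fromWitnessFalse)
open import Function.Bundles using (Inverse; mk↔ₛ′; Equivalence)
open import Function.Properties.Inverse using (↔-sym)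

-- Every boundary point lies on exactly one segment, and a circle never meets
-- the boundary. Hence a path leaving a boundary point x runs along the segment
-- at x and arrives at its other end y, which is again a boundary point with no
-- way onward except back along the same segment. A reduced path between
-- distinct boundary points is therefore a single segment, so the edges of
-- Γ₁(M) are exactly the segments of M, and an isomorphism Γ₁(M) ≅ Γ₁(N) fixing
-- the vertices matches the segments of M with those of N. The wager supplies
-- the count of circles.

_≐_ : {A : Set} → A × A → A × A → Set
p ≐ q = p ≡ q ⊎ p ≡ swap q

≐-sym : {A : Set} {p q : A × A} → p ≐ q → q ≐ p
≐-sym (inj₁ p≡q)  = inj₁ (sym p≡q)
≐-sym (inj₂ p≡q˘) = inj₂ (sym (cong swap p≡q˘))

≅G-sym : {V : Set} {G H : Graph V} → G ≅G H → H ≅G G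
≅G-sym {G = G} {H} (φ , src≡ , tgt≡) = ↔-sym φ , src≡˘ , tgt≡˘
  where
  open Inverse φ
  src≡˘ : ∀ e → src G (from e) ≡ src H e
  src≡˘ e = trans (sym (src≡ (from e))) (cong (src H) (strictlyInverseˡ e))
  tgt≡˘ : ∀ e → tgt G (from e) ≡ tgt H e
  tgt≡˘ e = trans (sym (tgt≡ (from e))) (cong (tgt H) (strictlyInverseˡ e))

module _ {a b : ℕ} (M : Cob a b) where

  endpt-injective : ∀ {p q} → endpt (ends M) p ≡ endpt (ends M) q → p ≡ q
  endpt-injective = proj₁ (boundary M)

  endpt⁻¹ : Bd a b → Fin (nseg M) × Bool
  endpt⁻¹ x = proj₁ (proj₂ (boundary M) x)

  endpt∘endpt⁻¹ : ∀ x → endpt (ends M) (endpt⁻¹ x) ≡ x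
  endpt∘endpt⁻¹ x = proj₂ (proj₂ (boundary M) x) refl

  segmentAt : Bd a b → Fin (nseg M)
  segmentAt x = proj₁ (endpt⁻¹ x)

  segmentAt-endpt : ∀ j s → segmentAt (endpt (ends M) (j , s)) ≡ j
  segmentAt-endpt j s =
    cong proj₁ (endpt-injective {endpt⁻¹ (endpt (ends M) (j , s))} {j , s} (endpt∘endpt⁻¹ _))

  segmentAt-≐ : ∀ {j p} → ends M j ≐ p → segmentAt (proj₁ p) ≡ j
  segmentAt-≐ {j} (inj₁ e) = trans (cong segmentAt (sym (cong proj₁ e))) (segmentAt-endpt j false)
  segmentAt-≐ {j} (inj₂ e) = trans (cong segmentAt (sym (cong proj₂ e))) (segmentAt-endpt j true)

  ≐-segmentAt : ∀ {j p} → ends M j ≐ p → ends M (segmentAt (proj₁ p)) ≐ p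
  ≐-segmentAt {p = p} e = subst (λ k → ends M k ≐ p) (sym (segmentAt-≐ e)) e

  endpoints-distinct : ∀ i → proj₁ (ends M i) ≢ proj₂ (ends M i)
  endpoints-distinct i e with endpt-injective {i , false} {i , true} e
  ... | ()

  traversal-≐ : ∀ {x y} j d → endpt (ends M) (j , d) ≡ x → endpt (ends M) (j , not d) ≡ y →
                ends M j ≐ (x , y)
  traversal-≐ j false src≡ tgt≡ = inj₁ (cong₂ _,_ src≡ tgt≡)
  traversal-≐ j true  src≡ tgt≡ = inj₂ (cong₂ _,_ tgt≡ src≡)

  osrc-segment : ∀ j d → osrc M (inj₁ j , d) ≡ inj₁ (endpt (ends M) (j , d))
  osrc-segment j false = refl
  osrc-segment j true  = refl

  otgt-segment : ∀ j d → otgt M (inj₁ j , d) ≡ inj₁ (endpt (ends M) (j , not d))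
  otgt-segment j false = refl
  otgt-segment j true  = refl

  circle-off-boundary : ∀ k d {x} → osrc M (inj₂ k , d) ≢ inj₁ x
  circle-off-boundary k false ()
  circle-off-boundary k true  ()

  isPath-[]⁻ : ∀ {x y} → T (isPath M x y []) → x ≡ y
  isPath-[]⁻ = toWitness

  isPath-[]⁺ : ∀ x → T (isPath M x x [])
  isPath-[]⁺ x = fromWitness refl

  isPath-∷⁺ : ∀ {x y} o os → osrc M o ≡ x → T (isPath M (otgt M o) y os) →
              T (isPath M x y (o ∷ os))
  isPath-∷⁺ o os src≡ rest = Equivalence.from T-∧ (fromWitness src≡ , rest)

  isPath-∷⁻ : ∀ {x y} o os → T (isPath M x y (o ∷ os)) →
              osrc M o ≡ x × T (isPath M (otgt M o) y os)
  isPath-∷⁻ o os p with Equivalence.to T-∧ p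
  ... | src≡ , rest = toWitness src≡ , rest

  no-backtracking : ∀ e d d' os → T (isReduced M ((e , d) ∷ (e , d') ∷ os)) → d ≡ d'
  no-backtracking e d d' os r with ≡-dec _≟ᶠ_ _≟ᶠ_ e e | d ≟ d'
  ... | _        | yes d≡d' = d≡d'
  ... | yes _    | no _     = ⊥-elim r
  ... | no e≢e   | no _     = ⊥-elim (e≢e refl)

  stuck-at-boundary : ∀ j d o os {y} → T (isPath M (otgt M (inj₁ j , d)) y (o ∷ os)) →
                      T (isReduced M ((inj₁ j , d) ∷ o ∷ os)) → ⊥
  stuck-at-boundary j d (inj₂ k , d') os p r =
    circle-off-boundary k d' (trans (proj₁ (isPath-∷⁻ (inj₂ k , d') os p)) (otgt-segment j d))
  stuck-at-boundary j d (inj₁ j' , d') os p r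
    with endpt-injective {j' , d'} {j , not d}
           (inj₁-injective (trans (sym (osrc-segment j' d'))
                                  (trans (proj₁ (isPath-∷⁻ (inj₁ j' , d') os p)) (otgt-segment j d))))
  ... | refl = not-¬ refl (no-backtracking (inj₁ j) d (not d) os r)

  reduced-path-along-segment : ∀ {x y} → x ≢ y → ∀ w →
    T (isPath M (inj₁ x) (inj₁ y) w) → T (isReduced M w) → Σ[ j ∈ Fin (nseg M) ] ends M j ≐ (x , y)
  reduced-path-along-segment x≢y [] p r = ⊥-elim (x≢y (inj₁-injective (isPath-[]⁻ p)))
  reduced-path-along-segment x≢y ((inj₂ k , d) ∷ w) p r =
    ⊥-elim (circle-off-boundary k d (proj₁ (isPath-∷⁻ (inj₂ k , d) w p)))
  reduced-path-along-segment x≢y ((inj₁ j , d) ∷ []) p r with isPath-∷⁻ (inj₁ j , d) [] p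
  ... | src≡ , tgt≡ =
    j , traversal-≐ j d (inj₁-injective (trans (sym (osrc-segment j d)) src≡))
                        (inj₁-injective (trans (sym (otgt-segment j d)) (isPath-[]⁻ tgt≡)))
  reduced-path-along-segment x≢y ((inj₁ j , d) ∷ o ∷ w) p r =
    ⊥-elim (stuck-at-boundary j d o w (proj₂ (isPath-∷⁻ (inj₁ j , d) (o ∷ w) p)) r)

  Γ₁-edge-along-segment : (e : Γ₁E M) →
    Σ[ j ∈ Fin (nseg M) ] ends M j ≐ (src (Γ₁ M) e , tgt (Γ₁ M) e)
  Γ₁-edge-along-segment (x , y , x≢y , w , p , r) =
    reduced-path-along-segment (toWitnessFalse x≢y) w p r

  segment-edge : Fin (nseg M) → Γ₁E M
  segment-edge i = proj₁ (ends M i) , proj₂ (ends M i) , fromWitnessFalse (endpoints-distinct i) ,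
                   (inj₁ i , false) ∷ [] , isPath-∷⁺ (inj₁ i , false) [] refl (isPath-[]⁺ _) , _

Γ₁-≅-segments : ∀ {a b} (M N : Cob a b) → Γ₁ M ≅G Γ₁ N →
                ∀ i → Σ[ j ∈ Fin (nseg N) ] ends N j ≐ ends M i
Γ₁-≅-segments M N (φ , src≡ , tgt≡) i
  with Γ₁-edge-along-segment N (Inverse.to φ (segment-edge M i))
... | j , e = j , subst (ends N j ≐_) (cong₂ _,_ (src≡ (segment-edge M i)) (tgt≡ (segment-edge M i))) e

segments-match⇒≅Cob : ∀ {a b} (M N : Cob a b) →
  (∀ i → Σ[ j ∈ Fin (nseg N) ] ends N j ≐ ends M i) →
  (∀ j → Σ[ i ∈ Fin (nseg M) ] ends M i ≐ ends N j) →
  ncirc M ≡ ncirc N → M ≅Cob N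
segments-match⇒≅Cob M N M⊆N N⊆M circles = mk↔ₛ′ fw bw fw∘bw bw∘fw , fw-≐ , circles
  where
  fw : Fin (nseg M) → Fin (nseg N)
  fw i = segmentAt N (proj₁ (ends M i))
  bw : Fin (nseg N) → Fin (nseg M)
  bw j = segmentAt M (proj₁ (ends N j))
  fw-≐ : ∀ i → ends N (fw i) ≐ ends M i
  fw-≐ i = ≐-segmentAt N (proj₂ (M⊆N i))
  bw-≐ : ∀ j → ends M (bw j) ≐ ends N j
  bw-≐ j = ≐-segmentAt M (proj₂ (N⊆M j))
  fw∘bw : ∀ j → fw (bw j) ≡ j
  fw∘bw j = segmentAt-≐ N (≐-sym (bw-≐ j))
  bw∘fw : ∀ i → bw (fw i) ≡ i
  bw∘fw i = segmentAt-≐ M (≐-sym (fw-≐ i))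

mainTheorem3 : (a b : ℕ) (M N : Cob a b) → F̄ M ≅P F̄ N → M ≅Cob N
mainTheorem3 a b M N (Γ₁M≅Γ₁N , circles) =
  segments-match⇒≅Cob M N
    (Γ₁-≅-segments M N Γ₁M≅Γ₁N)
    (Γ₁-≅-segments N M (≅G-sym Γ₁M≅Γ₁N))
    circles
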